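{- Assume the Weighted Budgeted Matching instance $(G,p,(V_g),(\rho_g))$ admits a feasible solution. Let $\mathcal{M}_H$ be a maximum-weight matching in the graph $H$ constructed in the context, and let $\mathcal{M}=\mathcal{M}_H\cap E$. Then the total original weight $\sum_{e\in\mathcal{M}}p_e$ equals the optimum value of the Weighted Budgeted Matching instance (and $\mathcal{M}$ is an optimal solution to it).
   Context: Weighted Budgeted Matching instance: a graph $G=(V,E)$ with $n=|V|$, edge weights $p:E\to\mathbb{R}_{\ge 0}$, a partition $V=V_1\cup\dots\cup V_\omega$, and integers $0\le\rho_g\le|V_g|$; the goal is a minimum-weight matching of $G$ in which at least $\rho_g$ vertices of each $V_g$ are matched. Construction: fix a number $M>\sum_{e\in E}p_e$. Let $H$ be the graph obtained from $G$ by adding, for each $g$, a set $V'_g$ of $|V_g|-\rho_g$ new vertices and all edges between $V'_g$ and $V_g$. Edge weights in $H$: an edge $e\in E$ has weight $2M-p_e$, and each added edge $(x,y)$ with $x\in V'_g$, $y\in V_g$ has weight $M$.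
   Formalization: The edge weights $p$ and the number $M$ are rational rather than real. -}

module Defs where

open import Data.Nat using (ℕ; _∸_)
open import Data.Fin using (Fin; _≟_; _<_)
open import Data.List using (List; []; _∷_; _++_; length; filter; foldr; map; mapMaybe; allFin; concatMap)
open import Data.List.Relation.Unary.All using (All)
open import Data.List.Relation.Unary.Unique.Propositional using (Unique)
open import Data.Maybe using (Maybe; just; nothing)
open import Data.Product using (Σ; Σ-syntax; _×_; _,_; proj₁; proj₂)
open import Data.Sum using (_⊎_; inj₁; inj₂)
open import Data.Bool using (Bool; true; false; if_then_else_)
open import Data.Empty using (⊥)
open import Relation.Binary.PropositionalEquality using (_≡_)
open import Relation.Nullary using (Dec; yes; no)
open import Relation.Nullary.Decidable using (⌊_⌋)
open import Data.Rational using (ℚ; 0ℚ; _+_; _-_)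

-- Generic matchings over an arbitrary vertex type.
-- A (candidate) matching is a list of ordered pairs (u , v), each pair
-- standing for the edge {u , v}.

endpoints : ∀ {V : Set} → List (V × V) → List V
endpoints = concatMap (λ e → proj₁ e ∷ proj₂ e ∷ [])

IsMatching : ∀ {V : Set} → (V → V → Set) → List (V × V) → Set
IsMatching Adj m = All (λ e → Adj (proj₁ e) (proj₂ e)) m × Unique (endpoints m)

weight : ∀ {V : Set} → (V → V → ℚ) → List (V × V) → ℚ
weight w m = foldr (λ e acc → w (proj₁ e) (proj₂ e) + acc) 0ℚ m

AdjG : ∀ {n} → (Fin n → Fin n → Bool) → Fin n → Fin n → Set
AdjG adj u v = adj u v ≡ true

totalWeight : ∀ {n} → (Fin n → Fin n → Bool) → (Fin n → Fin n → ℚ) → ℚ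
totalWeight {n} adj p =
  weight p (filter (λ e → Data.Bool._≟_ (adj (proj₁ e) (proj₂ e)) true)
             (filter (λ e → Data.Fin._<?_ (proj₁ e) (proj₂ e))
               (concatMap (λ u → map (λ v → (u , v)) (allFin n)) (allFin n))))

-- |V_g| where c : Fin n → Fin ω assigns each vertex to its part
partSize : ∀ {n ω} → (Fin n → Fin ω) → Fin ω → ℕ
partSize {n} c g = length (filter (λ i → c i ≟ g) (allFin n))

matchedIn : ∀ {n ω} → (Fin n → Fin ω) → Fin ω → List (Fin n × Fin n) → ℕ
matchedIn c g m = length (filter (λ v → c v ≟ g) (endpoints m))

IsFeasible : ∀ {n ω} → (Fin n → Fin n → Bool) → (Fin n → Fin ω) → (Fin ω → ℕ)
           → List (Fin n × Fin n) → Set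
IsFeasible adj c ρ m =
  IsMatching (AdjG adj) m × (∀ g → ρ g Data.Nat.≤ matchedIn c g m)

-- The auxiliary graph H.
-- Vertices: V ⊎ (⋃_g V'_g), where V'_g has |V_g| - ρ_g new vertices.

VH : ∀ {n ω} → (Fin n → Fin ω) → (Fin ω → ℕ) → Set
VH {n} {ω} c ρ = Fin n ⊎ (Σ[ g ∈ Fin ω ] Fin (partSize c g ∸ ρ g))

AdjH : ∀ {n ω} (adj : Fin n → Fin n → Bool) (c : Fin n → Fin ω) (ρ : Fin ω → ℕ)
     → VH c ρ → VH c ρ → Set
AdjH adj c ρ (inj₁ u) (inj₁ v) = adj u v ≡ true
AdjH adj c ρ (inj₁ u) (inj₂ (g , _)) = c u ≡ g
AdjH adj c ρ (inj₂ (g , _)) (inj₁ v) = c v ≡ g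
AdjH adj c ρ (inj₂ _) (inj₂ _) = ⊥

-- weights in H: 2M - p_e on original edges, M on added edges
-- (value on non-edges is irrelevant; set to 0)
weightH : ∀ {n ω} (c : Fin n → Fin ω) (ρ : Fin ω → ℕ) (p : Fin n → Fin n → ℚ) (M : ℚ)
        → VH c ρ → VH c ρ → ℚ
weightH c ρ p M (inj₁ u) (inj₁ v) = (M + M) - p u v
weightH c ρ p M (inj₁ _) (inj₂ _) = M
weightH c ρ p M (inj₂ _) (inj₁ _) = M
weightH c ρ p M (inj₂ _) (inj₂ _) = 0ℚ

restrictToG : ∀ {n ω} {c : Fin n → Fin ω} {ρ : Fin ω → ℕ}
            → List (VH c ρ × VH c ρ) → List (Fin n × Fin n)
restrictToG = mapMaybe f
  where
  f : _ → Maybe _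
  f (inj₁ u , inj₁ v) = just (u , v)
  f _ = nothing

{-# OPTIONS --safe #-}
-- Every vertex of V covered by an edge of H contributes M to its weight, and an edge of G also loses
-- its original weight; so for every list m of edges of H,
--   w_H(m) + p(m ∩ E) = M · #(vertices of V covered by m).
-- A feasible solution m extends to a matching of H covering V: the unmatched vertices of each V_g
-- (at most |V_g| − ρ_g of them) are joined to distinct vertices of V′_g. That matching weighs M·n − p(m),
-- and p(m) ≤ Σ_E p < M, so a maximum-weight matching M_H of H must cover V as well. Then at most
-- |V_g| − ρ_g vertices of V_g are matched into V′_g, so M_H ∩ E is feasible, and w_H(M_H) ≥ M·n − p(m)
-- reads p(M_H ∩ E) ≤ p(m).

module Submission where

open import Defs
open import Data.Nat using (ℕ)
open import Data.Fin using (Fin)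
open import Data.List using (List)
open import Data.Product using (Σ; _×_; _,_)
open import Data.Bool using (Bool; true; false)
open import Relation.Binary.PropositionalEquality using (_≡_)
open import Data.Rational using (ℚ; 0ℚ; _≤_; _<_)

open import Algebra.Bundles using (CommutativeMonoid)
open import Axiom.UniquenessOfIdentityProofs using (module Decidable⇒UIP)
import Data.Bool as Bool
open import Data.Empty using (⊥)
import Data.Fin as Fin
import Data.Fin.Properties as Finₚ
open import Data.List using ([]; _∷_; _++_; length; map; filter; concatMap; allFin; zip)
open import Data.List.Properties
  using (length-++; length-map; length-tabulate; ++-identityʳ; concatMap-++; mapMaybe-++; mapMaybe-map-retract)
open import Data.List.Membership.Propositional using (_∈_; _∉_)
open import Data.List.Membership.Propositional.Properties
  using (∈-∃++; ∈-++⁻; ∈-++⁺ˡ; ∈-++⁺ʳ; ∈-map⁺; ∈-map⁻; ∈-filter⁺; ∈-filter⁻; ∈-allFin; ∈-concat⁺′; ∈-concat⁻′)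
open import Data.List.Relation.Binary.Disjoint.Propositional using (Disjoint)
open import Data.List.Relation.Binary.Permutation.Propositional as ↭ using (_↭_; ↭-refl; ↭-trans)
open import Data.List.Relation.Binary.Permutation.Propositional.Properties using (shift; ∈-resp-↭; ↭-length)
open import Data.List.Relation.Binary.Subset.Propositional using (_⊆_)
open import Data.List.Relation.Unary.All as All using (All; []; _∷_)
import Data.List.Relation.Unary.All.Properties as All
open import Data.List.Relation.Unary.AllPairs using ([]; _∷_)
open import Data.List.Relation.Unary.Any using (here; there; any?)
open import Data.List.Relation.Unary.Unique.Propositional using (Unique)
import Data.List.Relation.Unary.Unique.Propositional.Properties as Unique
import Data.Nat as ℕ
open import Data.Nat using (zero; suc; _∸_)
import Data.Nat.Properties as ℕₚ
import Data.Product as Product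
open import Data.Product using (∃-syntax; proj₁; proj₂)
open import Data.Product.Properties using (,-injectiveʳ-UIP)
open import Data.Rational using (_+_; _-_)
import Data.Rational.Properties as ℚₚ
open import Data.Rational.Solver using (module +-*-Solver)
import Data.Sum as Sum
open import Data.Sum using (_⊎_; inj₁; inj₂)
open import Data.Sum.Properties using (inj₁-injective; inj₂-injective)
open import Data.Unit using (⊤; tt)
open import Function using (id; _∘_; case_of_)
open import Relation.Binary.Definitions using (tri<; tri≈; tri>)
open import Relation.Binary.PropositionalEquality
  using (_≢_; refl; sym; trans; cong; cong₂; subst; subst₂; module ≡-Reasoning)
open import Relation.Nullary using (Dec; yes; no; ¬?; contradiction)
open import Relation.Unary using (Decidable)

open import Algebra.Properties.CommutativeSemigroup
  (CommutativeMonoid.commutativeSemigroup ℚₚ.+-0-commutativeMonoid) using (x∙yz≈y∙xz)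
open import Algebra.Properties.Monoid.Mult ℚₚ.+-0-monoid using () renaming (_×_ to _·_)
open +-*-Solver using (solve; _:+_; _:-_; _:=_)

module _ {a} {A : Set a} where

  Unique-⊆⇒↭++ : ∀ {xs ys : List A} → Unique xs → xs ⊆ ys → ∃[ zs ] ys ↭ xs ++ zs
  Unique-⊆⇒↭++ {[]} {ys} [] _ = ys , ↭-refl
  Unique-⊆⇒↭++ {x ∷ xs} (x∉xs ∷ xs!) xs⊆ys with ws , ws′ , refl ← ∈-∃++ (xs⊆ys (here refl)) =
    let zs , ws++ws′↭xs++zs = Unique-⊆⇒↭++ xs! xs⊆ws++ws′
    in zs , ↭-trans (shift x ws ws′) (↭.prep x ws++ws′↭xs++zs)
    where
    xs⊆ws++ws′ : xs ⊆ ws ++ ws′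
    xs⊆ws++ws′ y∈xs with ∈-resp-↭ (shift x ws ws′) (xs⊆ys (there y∈xs))
    ... | here refl = contradiction refl (All.lookup x∉xs y∈xs)
    ... | there y∈ws++ws′ = y∈ws++ws′

  Unique-⊆⇒length≤ : ∀ {xs ys : List A} → Unique xs → xs ⊆ ys → length xs ℕ.≤ length ys
  Unique-⊆⇒length≤ {xs} xs! xs⊆ys =
    let zs , ys↭xs++zs = Unique-⊆⇒↭++ xs! xs⊆ys
    in ℕₚ.≤-trans (ℕₚ.m≤m+n (length xs) (length zs))
         (ℕₚ.≤-reflexive (trans (sym (length-++ xs)) (sym (↭-length ys↭xs++zs))))

  Unique-⊆-length≥⇒⊇ : ∀ {xs ys : List A} → Unique xs → xs ⊆ ys → length ys ℕ.≤ length xs → ys ⊆ xs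
  Unique-⊆-length≥⇒⊇ {xs} xs! xs⊆ys ys≤xs with Unique-⊆⇒↭++ xs! xs⊆ys
  ... | [] , ys↭xs++[] = λ y∈ys → subst (_ ∈_) (++-identityʳ xs) (∈-resp-↭ ys↭xs++[] y∈ys)
  ... | z ∷ zs , ys↭xs++z∷zs = contradiction ys≤xs (ℕₚ.<⇒≱ (begin-strict
      length xs                 <⟨ ℕₚ.m<m+n (length xs) ℕ.z<s ⟩
      length xs ℕ.+ length (z ∷ zs) ≡⟨ length-++ xs ⟨
      length (xs ++ z ∷ zs)     ≡⟨ ↭-length ys↭xs++z∷zs ⟨
      _ ∎))
    where open ℕₚ.≤-Reasoning

module _ {V : Set} (w : V → V → ℚ) where

  weight-++ : ∀ xs ys → weight w (xs ++ ys) ≡ weight w xs + weight w ys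
  weight-++ [] ys = sym (ℚₚ.+-identityˡ (weight w ys))
  weight-++ ((u , v) ∷ xs) ys = trans (cong (w u v +_) (weight-++ xs ys)) (sym (ℚₚ.+-assoc (w u v) _ _))

  weight-↭ : ∀ {xs ys} → xs ↭ ys → weight w xs ≡ weight w ys
  weight-↭ ↭.refl = refl
  weight-↭ (↭.prep (u , v) xs↭ys) = cong (w u v +_) (weight-↭ xs↭ys)
  weight-↭ (↭.swap (u , v) (u′ , v′) xs↭ys) =
    trans (x∙yz≈y∙xz (w u v) (w u′ v′) _) (cong (λ r → w u′ v′ + (w u v + r)) (weight-↭ xs↭ys))
  weight-↭ (↭.trans xs↭ys ys↭zs) = trans (weight-↭ xs↭ys) (weight-↭ ys↭zs)

  module _ (w≥0 : ∀ u v → 0ℚ ≤ w u v) where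

    weight-nonNeg : ∀ m → 0ℚ ≤ weight w m
    weight-nonNeg [] = ℚₚ.≤-refl
    weight-nonNeg ((u , v) ∷ m) = ℚₚ.+-mono-≤ (w≥0 u v) (weight-nonNeg m)

    weight-mono-⊆ : ∀ {xs ys} → Unique xs → xs ⊆ ys → weight w xs ≤ weight w ys
    weight-mono-⊆ {xs} {ys} xs! xs⊆ys = let zs , ys↭xs++zs = Unique-⊆⇒↭++ xs! xs⊆ys in begin
      weight w xs                   ≡⟨ ℚₚ.+-identityʳ (weight w xs) ⟨
      weight w xs + 0ℚ              ≤⟨ ℚₚ.+-monoʳ-≤ (weight w xs) (weight-nonNeg zs) ⟩
      weight w xs + weight w zs     ≡⟨ weight-++ xs zs ⟨
      weight w (xs ++ zs)           ≡⟨ weight-↭ ys↭xs++zs ⟨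
      weight w ys                   ∎
      where open ℚₚ.≤-Reasoning

module _ {V : Set} where

  ∈-endpoints⁺ˡ : ∀ {u v : V} {m} → (u , v) ∈ m → u ∈ endpoints m
  ∈-endpoints⁺ˡ (here refl) = here refl
  ∈-endpoints⁺ˡ {m = _ ∷ _} (there e∈m) = there (there (∈-endpoints⁺ˡ e∈m))

  ∈-endpoints⁺ʳ : ∀ {u v : V} {m} → (u , v) ∈ m → v ∈ endpoints m
  ∈-endpoints⁺ʳ (here refl) = there (here refl)
  ∈-endpoints⁺ʳ {m = _ ∷ _} (there e∈m) = there (there (∈-endpoints⁺ʳ e∈m))

  endpoints-concatMap : ∀ {L : Set} (f : L → List (V × V)) ls
                      → endpoints (concatMap f ls) ≡ concatMap (endpoints ∘ f) ls
  endpoints-concatMap f [] = refl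
  endpoints-concatMap f (l ∷ ls) =
    trans (concatMap-++ _ (f l) (concatMap f ls)) (cong (endpoints (f l) ++_) (endpoints-concatMap f ls))

  ∈-endpoints-zip⁻ : ∀ {x : V} xs ys → x ∈ endpoints (zip xs ys) → x ∈ xs ⊎ x ∈ ys
  ∈-endpoints-zip⁻ (_ ∷ _) (_ ∷ _) (here refl) = inj₁ (here refl)
  ∈-endpoints-zip⁻ (_ ∷ _) (_ ∷ _) (there (here refl)) = inj₂ (here refl)
  ∈-endpoints-zip⁻ (_ ∷ xs) (_ ∷ ys) (there (there x∈)) =
    Sum.map there there (∈-endpoints-zip⁻ xs ys x∈)

  ∈-endpoints-zip⁺ : ∀ {x : V} {xs ys} → x ∈ xs → length xs ℕ.≤ length ys → x ∈ endpoints (zip xs ys)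
  ∈-endpoints-zip⁺ {ys = _ ∷ _} (here refl) _ = here refl
  ∈-endpoints-zip⁺ {ys = _ ∷ _} (there x∈xs) (ℕ.s≤s xs≤ys) = there (there (∈-endpoints-zip⁺ x∈xs xs≤ys))

  All-zip : ∀ {R : V × V → Set} {xs ys} → (∀ {x y} → x ∈ xs → y ∈ ys → R (x , y)) → All R (zip xs ys)
  All-zip {xs = []} _ = []
  All-zip {xs = _ ∷ _} {[]} _ = []
  All-zip {xs = _ ∷ _} {_ ∷ _} R-pairs =
    R-pairs (here refl) (here refl) ∷ All-zip λ x∈ y∈ → R-pairs (there x∈) (there y∈)

  endpoints-zip-Unique : ∀ {xs ys : List V} → Unique xs → Unique ys → Disjoint xs ys
                       → Unique (endpoints (zip xs ys))
  endpoints-zip-Unique {[]} _ _ _ = []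
  endpoints-zip-Unique {_ ∷ _} {[]} _ _ _ = []
  endpoints-zip-Unique {x ∷ xs} {y ∷ ys} (x∉xs ∷ xs!) (y∉ys ∷ ys!) xs#ys =
    (x≢y ∷ All.tabulate x-fresh) ∷
    (All.tabulate y-fresh ∷ endpoints-zip-Unique xs! ys! (xs#ys ∘ Product.map there there))
    where
    x≢y : x ≢ y
    x≢y refl = xs#ys (here refl , here refl)
    x-fresh : ∀ {z} → z ∈ endpoints (zip xs ys) → x ≢ z
    x-fresh z∈ refl with ∈-endpoints-zip⁻ xs ys z∈
    ... | inj₁ x∈xs = All.lookup x∉xs x∈xs refl
    ... | inj₂ x∈ys = xs#ys (here refl , there x∈ys)
    y-fresh : ∀ {z} → z ∈ endpoints (zip xs ys) → y ≢ z
    y-fresh z∈ refl with ∈-endpoints-zip⁻ xs ys z∈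
    ... | inj₁ y∈xs = xs#ys (there y∈xs , here refl)
    ... | inj₂ y∈ys = All.lookup y∉ys y∈ys refl

module _ {L V : Set} (label : V → L) (block : L → List V) where

  Unique-concatMap : ∀ {ls} → Unique ls → (∀ l → Unique (block l))
                   → (∀ l {x} → x ∈ block l → label x ≡ l) → Unique (concatMap block ls)
  Unique-concatMap {[]} [] _ _ = []
  Unique-concatMap {l ∷ ls} (l∉ls ∷ ls!) blocks! labelled =
    Unique.++⁺ (blocks! l) (Unique-concatMap ls! blocks! labelled) block#rest
    where
    block#rest : Disjoint (block l) (concatMap block ls)
    block#rest (x∈block , x∈rest) with ∈-concat⁻′ (map block ls) x∈rest
    ... | _ , x∈block′ , block′∈ with ∈-map⁻ block block′∈
    ...   | l′ , l′∈ls , refl =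
      All.lookup l∉ls l′∈ls (trans (sym (labelled l x∈block)) (labelled l′ x∈block′))

module _ {n : ℕ} where

  orient : Fin n × Fin n → Fin n × Fin n
  orient (u , v) with u Fin.<? v
  ... | yes _ = u , v
  ... | no _ = v , u

  orient-≡⇒sharedEndpoint : ∀ {u v u′ v′} → orient (u , v) ≡ orient (u′ , v′) → u ≡ u′ ⊎ u ≡ v′
  orient-≡⇒sharedEndpoint {u} {v} {u′} {v′} eq with u Fin.<? v | u′ Fin.<? v′
  ... | yes _ | yes _ = inj₁ (cong proj₁ eq)
  ... | yes _ | no _  = inj₂ (cong proj₁ eq)
  ... | no _  | yes _ = inj₂ (cong proj₂ eq)
  ... | no _  | no _  = inj₁ (cong proj₂ eq)

  orient-Unique : ∀ m → Unique (endpoints m) → Unique (map orient m)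
  orient-Unique [] _ = []
  orient-Unique ((u , v) ∷ m) ((_ ∷ u∉m) ∷ (_ ∷ m!)) = All.tabulate orient-new ∷ orient-Unique m m!
    where
    orient-new : ∀ {e} → e ∈ map orient m → orient (u , v) ≢ e
    orient-new e∈ eq with ∈-map⁻ orient e∈
    ... | (u′ , v′) , e′∈m , refl with orient-≡⇒sharedEndpoint eq
    ... | inj₁ u≡u′ = All.lookup u∉m (∈-endpoints⁺ˡ e′∈m) u≡u′
    ... | inj₂ u≡v′ = All.lookup u∉m (∈-endpoints⁺ʳ e′∈m) u≡v′

  weight-orient : ∀ {p : Fin n → Fin n → ℚ} → (∀ u v → p u v ≡ p v u)
                → ∀ m → weight p (map orient m) ≡ weight p m
  weight-orient p-sym [] = refl
  weight-orient {p} p-sym ((u , v) ∷ m) = cong₂ _+_ p-orient (weight-orient p-sym m)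
    where
    p-orient : p (proj₁ (orient (u , v))) (proj₂ (orient (u , v))) ≡ p u v
    p-orient with u Fin.<? v
    ... | yes _ = refl
    ... | no _ = p-sym v u

  -- the list summed in totalWeight, so that totalWeight adj p is weight p (edges adj) by definition
  edges : (Fin n → Fin n → Bool) → List (Fin n × Fin n)
  edges adj = filter (λ e → adj (proj₁ e) (proj₂ e) Bool.≟ true)
                (filter (λ e → proj₁ e Fin.<? proj₂ e)
                  (concatMap (λ u → map (λ v → (u , v)) (allFin n)) (allFin n)))

  module _ {adj : Fin n → Fin n → Bool}
           (adj-sym : ∀ u v → adj u v ≡ adj v u) (adj-irr : ∀ u → adj u u ≡ false) where

    ∈-edges : ∀ {u v} → adj u v ≡ true → u Fin.< v → (u , v) ∈ edges adj
    ∈-edges {u} {v} uv∈E u<v =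
      ∈-filter⁺ _ (∈-filter⁺ _ uv∈pairs u<v) uv∈E
      where
      uv∈pairs = ∈-concat⁺′ (∈-map⁺ (u ,_) (∈-allFin v)) (∈-map⁺ _ (∈-allFin u))

    orient∈edges : ∀ {u v} → adj u v ≡ true → orient (u , v) ∈ edges adj
    orient∈edges {u} {v} uv∈E with u Fin.<? v
    ... | yes u<v = ∈-edges uv∈E u<v
    ... | no u≮v with Finₚ.<-cmp u v
    ...   | tri< u<v _ _ = contradiction u<v u≮v
    ...   | tri≈ _ refl _ = contradiction (trans (sym uv∈E) (adj-irr u)) λ ()
    ...   | tri> _ _ v<u = ∈-edges (trans (adj-sym v u) uv∈E) v<u

    weight≤totalWeight : ∀ {p : Fin n → Fin n → ℚ} → (∀ u v → p u v ≡ p v u) → (∀ u v → 0ℚ ≤ p u v)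
                       → ∀ {m} → IsMatching (AdjG adj) m → weight p m ≤ totalWeight adj p
    weight≤totalWeight {p} p-sym p≥0 {m} (m⊆E , m!) = begin
      weight p m              ≡⟨ weight-orient p-sym m ⟨
      weight p (map orient m) ≤⟨ weight-mono-⊆ p p≥0 (orient-Unique m m!) orient[m]⊆E ⟩
      weight p (edges adj)    ∎
      where
      open ℚₚ.≤-Reasoning
      orient[m]⊆E : map orient m ⊆ edges adj
      orient[m]⊆E e∈ with ∈-map⁻ orient e∈
      ... | _ , e∈m , refl = orient∈edges (All.lookup m⊆E e∈m)

module _ {M : ℚ} (0≤M : 0ℚ ≤ M) where

  ·-nonNeg : ∀ k → 0ℚ ≤ k · M
  ·-nonNeg zero = ℚₚ.≤-refl
  ·-nonNeg (suc k) = ℚₚ.+-mono-≤ 0≤M (·-nonNeg k)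

  ·-monoˡ-≤ : ∀ {k l} → k ℕ.≤ l → k · M ≤ l · M
  ·-monoˡ-≤ {l = l} ℕ.z≤n = ·-nonNeg l
  ·-monoˡ-≤ (ℕ.s≤s k≤l) = ℚₚ.+-monoʳ-≤ M (·-monoˡ-≤ k≤l)

  multiplicity-forced : ∀ {k n W P W′ P′} → k ℕ.≤ n → W + P ≡ k · M → W′ + P′ ≡ n · M
                      → W′ ≤ W → 0ℚ ≤ P → P′ < M → k ≡ n
  multiplicity-forced {k} {n} {W} {P} {W′} {P′} k≤n W+P≡kM W′+P′≡nM W′≤W 0≤P P′<M
    with ℕₚ.m≤n⇒m<n∨m≡n k≤n
  ... | inj₂ k≡n = k≡n
  ... | inj₁ k<n = contradiction nM<nM (ℚₚ.<-irrefl refl)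
    where
    open ℚₚ.≤-Reasoning
    nM<nM : n · M < n · M
    nM<nM = begin-strict
      n · M           ≡⟨ W′+P′≡nM ⟨
      W′ + P′         <⟨ ℚₚ.+-monoʳ-< W′ P′<M ⟩
      W′ + M          ≤⟨ ℚₚ.+-monoˡ-≤ M W′≤W ⟩
      W + M           ≡⟨ cong (_+ M) (ℚₚ.+-identityʳ W) ⟨
      (W + 0ℚ) + M    ≤⟨ ℚₚ.+-monoˡ-≤ M (ℚₚ.+-monoʳ-≤ W 0≤P) ⟩
      (W + P) + M     ≡⟨ cong (_+ M) W+P≡kM ⟩
      k · M + M       ≡⟨ ℚₚ.+-comm (k · M) M ⟩
      suc k · M       ≤⟨ ·-monoˡ-≤ k<n ⟩
      n · M           ∎

p+q≡r+s∧r≤p⇒q≤s : ∀ {p q r s : ℚ} → p + q ≡ r + s → r ≤ p → q ≤ s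
p+q≡r+s∧r≤p⇒q≤s p+q≡r+s r≤p = ℚₚ.≮⇒≥ λ s<q →
  ℚₚ.<-irrefl (sym p+q≡r+s) (ℚₚ.+-mono-≤-< r≤p s<q)

module AuxiliaryGraph {n ω : ℕ} (adj : Fin n → Fin n → Bool) (c : Fin n → Fin ω) (ρ : Fin ω → ℕ) where

  EdgeH : VH c ρ × VH c ρ → Set
  EdgeH (x , y) = AdjH adj c ρ x y

  restrict : List (VH c ρ × VH c ρ) → List (Fin n × Fin n)
  restrict = restrictToG {c = c} {ρ = ρ}

  InV : VH c ρ → Set
  InV (inj₁ _) = ⊤
  InV (inj₂ _) = ⊥

  InV? : Decidable InV
  InV? (inj₁ _) = yes tt
  InV? (inj₂ _) = no λ ()

  InPart : Fin ω → VH c ρ → Set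
  InPart g (inj₁ v) = c v ≡ g
  InPart g (inj₂ _) = ⊥

  InPart? : ∀ g → Decidable (InPart g)
  InPart? g (inj₁ v) = c v Finₚ.≟ g
  InPart? g (inj₂ _) = no λ ()

  InNewPart : Fin ω → VH c ρ → Set
  InNewPart g (inj₁ _) = ⊥
  InNewPart g (inj₂ (g′ , _)) = g′ ≡ g

  InNewPart? : ∀ g → Decidable (InNewPart g)
  InNewPart? g (inj₁ _) = no λ ()
  InNewPart? g (inj₂ (g′ , _)) = g′ Finₚ.≟ g

  covered : List (VH c ρ × VH c ρ) → List (VH c ρ)
  covered m = filter InV? (endpoints m)

  CoversV : List (VH c ρ × VH c ρ) → Set
  CoversV m = ∀ v → inj₁ v ∈ endpoints m

  new : (g : Fin ω) → Fin (partSize c g ∸ ρ g) → VH c ρ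
  new g i = inj₂ (g , i)

  newPart : Fin ω → List (VH c ρ)
  newPart g = map (new g) (allFin (partSize c g ∸ ρ g))

  group : VH c ρ → Fin ω
  group (inj₁ v) = c v
  group (inj₂ (g , _)) = g

  lift : Fin n × Fin n → VH c ρ × VH c ρ
  lift = Product.map inj₁ inj₁

  weightH-identity : ∀ p M m
                   → weight (weightH c ρ p M) m + weight p (restrict m) ≡ length (covered m) · M
  weightH-identity p M [] = refl
  weightH-identity p M ((inj₁ u , inj₁ v) ∷ m) =
    trans (regroup M (p u v) _ _) (cong (λ r → M + (M + r)) (weightH-identity p M m))
    where
    regroup : ∀ M a W R → (((M + M) - a) + W) + (a + R) ≡ M + (M + (W + R))
    regroup = solve 4 (λ M a W R → (((M :+ M) :- a) :+ W) :+ (a :+ R) := M :+ (M :+ (W :+ R))) refl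
  weightH-identity p M ((inj₁ u , inj₂ _) ∷ m) =
    trans (ℚₚ.+-assoc M _ _) (cong (M +_) (weightH-identity p M m))
  weightH-identity p M ((inj₂ _ , inj₁ v) ∷ m) =
    trans (ℚₚ.+-assoc M _ _) (cong (M +_) (weightH-identity p M m))
  weightH-identity p M ((inj₂ _ , inj₂ _) ∷ m) =
    trans (cong (_+ weight p (restrict m)) (ℚₚ.+-identityˡ (weight (weightH c ρ p M) m)))
            (weightH-identity p M m)

  V : List (VH c ρ)
  V = map inj₁ (allFin n)

  length-V : length V ≡ n
  length-V = trans (length-map inj₁ (allFin n)) (length-tabulate id)

  V-Unique : Unique V
  V-Unique = Unique.map⁺ inj₁-injective (Unique.allFin⁺ n)

  covered⊆V : ∀ m → covered m ⊆ V
  covered⊆V m x∈ with ∈-filter⁻ InV? {xs = endpoints m} x∈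
  covered⊆V m {inj₁ v} x∈ | _ = ∈-map⁺ inj₁ (∈-allFin v)

  module _ (m : List (VH c ρ × VH c ρ)) where

    length-covered≤n : Unique (endpoints m) → length (covered m) ℕ.≤ n
    length-covered≤n m! =
      ℕₚ.≤-trans (Unique-⊆⇒length≤ (Unique.filter⁺ InV? m!) (covered⊆V m)) (ℕₚ.≤-reflexive length-V)

    CoversV⇒n≤length-covered : CoversV m → n ℕ.≤ length (covered m)
    CoversV⇒n≤length-covered m-covers =
      ℕₚ.≤-trans (ℕₚ.≤-reflexive (sym length-V)) (Unique-⊆⇒length≤ V-Unique V⊆covered)
      where
      V⊆covered : V ⊆ covered m
      V⊆covered x∈V with ∈-map⁻ inj₁ x∈V
      ... | v , _ , refl = ∈-filter⁺ InV? (m-covers v) tt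

    n≤length-covered⇒CoversV : Unique (endpoints m) → n ℕ.≤ length (covered m) → CoversV m
    n≤length-covered⇒CoversV m! n≤ v =
      proj₁ (∈-filter⁻ InV? {xs = endpoints m} (V⊆covered (∈-map⁺ inj₁ (∈-allFin v))))
      where
      V⊆covered : V ⊆ covered m
      V⊆covered = Unique-⊆-length≥⇒⊇ (Unique.filter⁺ InV? m!) (covered⊆V m)
                                      (ℕₚ.≤-trans (ℕₚ.≤-reflexive length-V) n≤)

  restrict-All : ∀ m → All EdgeH m → All (λ e → AdjG adj (proj₁ e) (proj₂ e)) (restrict m)
  restrict-All [] [] = []
  restrict-All ((inj₁ _ , inj₁ _) ∷ m) (uv∈E ∷ m⊆H) = uv∈E ∷ restrict-All m m⊆H
  restrict-All ((inj₁ _ , inj₂ _) ∷ m) (_ ∷ m⊆H) = restrict-All m m⊆H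
  restrict-All ((inj₂ _ , inj₁ _) ∷ m) (_ ∷ m⊆H) = restrict-All m m⊆H

  ∈-endpoints-restrict : ∀ m {v} → v ∈ endpoints (restrict m) → inj₁ v ∈ endpoints m
  ∈-endpoints-restrict ((inj₁ _ , inj₁ _) ∷ m) (here refl) = here refl
  ∈-endpoints-restrict ((inj₁ _ , inj₁ _) ∷ m) (there (here refl)) = there (here refl)
  ∈-endpoints-restrict ((inj₁ _ , inj₁ _) ∷ m) (there (there v∈)) =
    there (there (∈-endpoints-restrict m v∈))
  ∈-endpoints-restrict ((inj₁ _ , inj₂ _) ∷ m) v∈ = there (there (∈-endpoints-restrict m v∈))
  ∈-endpoints-restrict ((inj₂ _ , inj₁ _) ∷ m) v∈ = there (there (∈-endpoints-restrict m v∈))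
  ∈-endpoints-restrict ((inj₂ _ , inj₂ _) ∷ m) v∈ = there (there (∈-endpoints-restrict m v∈))

  restrict-Unique : ∀ m → Unique (endpoints m) → Unique (endpoints (restrict m))
  restrict-Unique [] _ = []
  restrict-Unique ((inj₁ u , inj₁ v) ∷ m) ((u≢v ∷ u∉m) ∷ (v∉m ∷ m!)) =
    (u≢v ∘ cong inj₁ ∷ All.tabulate (fresh u∉m)) ∷ (All.tabulate (fresh v∉m) ∷ restrict-Unique m m!)
    where
    fresh : ∀ {x} → All (inj₁ x ≢_) (endpoints m) → ∀ {y} → y ∈ endpoints (restrict m) → x ≢ y
    fresh x∉m y∈ x≡y = All.lookup x∉m (∈-endpoints-restrict m y∈) (cong inj₁ x≡y)
  restrict-Unique ((inj₁ _ , inj₂ _) ∷ m) (_ ∷ (_ ∷ m!)) = restrict-Unique m m!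
  restrict-Unique ((inj₂ _ , inj₁ _) ∷ m) (_ ∷ (_ ∷ m!)) = restrict-Unique m m!
  restrict-Unique ((inj₂ _ , inj₂ _) ∷ m) (_ ∷ (_ ∷ m!)) = restrict-Unique m m!

  restrict-isMatching : ∀ {m} → IsMatching (AdjH adj c ρ) m → IsMatching (AdjG adj) (restrict m)
  restrict-isMatching {m} (m⊆H , m!) = restrict-All m m⊆H , restrict-Unique m m!

  partCount newPartCount : Fin ω → List (VH c ρ × VH c ρ) → ℕ
  partCount g m = length (filter (InPart? g) (endpoints m))
  newPartCount g m = length (filter (InNewPart? g) (endpoints m))

  partCount≡matched+new : ∀ g m → All EdgeH m
                                   → partCount g m ≡ matchedIn c g (restrict m) ℕ.+ newPartCount g m
  partCount≡matched+new g [] [] = refl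
  partCount≡matched+new g ((inj₁ u , inj₁ v) ∷ m) (_ ∷ m⊆H) with c u Finₚ.≟ g
  ... | yes _ with c v Finₚ.≟ g
  ...   | yes _ = cong (suc ∘ suc) (partCount≡matched+new g m m⊆H)
  ...   | no _  = cong suc (partCount≡matched+new g m m⊆H)
  partCount≡matched+new g ((inj₁ u , inj₁ v) ∷ m) (_ ∷ m⊆H) | no _ with c v Finₚ.≟ g
  ...   | yes _ = cong suc (partCount≡matched+new g m m⊆H)
  ...   | no _  = partCount≡matched+new g m m⊆H
  partCount≡matched+new g ((inj₁ u , inj₂ (g′ , _)) ∷ m) (refl ∷ m⊆H) with c u Finₚ.≟ g
  ... | yes _ = trans (cong suc (partCount≡matched+new g m m⊆H)) (sym (ℕₚ.+-suc _ _))
  ... | no _  = partCount≡matched+new g m m⊆H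
  partCount≡matched+new g ((inj₂ (g′ , _) , inj₁ v) ∷ m) (refl ∷ m⊆H) with c v Finₚ.≟ g
  ... | yes _ = trans (cong suc (partCount≡matched+new g m m⊆H)) (sym (ℕₚ.+-suc _ _))
  ... | no _  = partCount≡matched+new g m m⊆H

  length-newPart : ∀ g → length (newPart g) ≡ partSize c g ∸ ρ g
  length-newPart g = trans (length-map (new g) (allFin _)) (length-tabulate id)

  newPart-Unique : ∀ g → Unique (newPart g)
  newPart-Unique g =
    Unique.map⁺ (,-injectiveʳ-UIP (Decidable⇒UIP.≡-irrelevant Finₚ._≟_) ∘ inj₂-injective) (Unique.allFin⁺ _)

  newPartCount≤ : ∀ g m → Unique (endpoints m) → newPartCount g m ℕ.≤ partSize c g ∸ ρ g
  newPartCount≤ g m m! =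
    ℕₚ.≤-trans (Unique-⊆⇒length≤ (Unique.filter⁺ (InNewPart? g) m!) ⊆newPart)
               (ℕₚ.≤-reflexive (length-newPart g))
    where
    ⊆newPart : filter (InNewPart? g) (endpoints m) ⊆ newPart g
    ⊆newPart x∈ with ∈-filter⁻ (InNewPart? g) {xs = endpoints m} x∈
    ⊆newPart {inj₂ (_ , i)} x∈ | _ , refl = ∈-map⁺ (new g) (∈-allFin i)

  partSize≤partCount : ∀ g m → CoversV m → partSize c g ℕ.≤ partCount g m
  partSize≤partCount g m m-covers = ℕₚ.≤-trans (ℕₚ.≤-reflexive (sym (length-map inj₁ part)))
    (Unique-⊆⇒length≤ (Unique.map⁺ inj₁-injective (Unique.filter⁺ _ (Unique.allFin⁺ n))) ⊆partCount)
    where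
    part = filter (λ v → c v Finₚ.≟ g) (allFin n)
    ⊆partCount : map inj₁ part ⊆ filter (InPart? g) (endpoints m)
    ⊆partCount x∈ with ∈-map⁻ inj₁ x∈
    ... | v , v∈part , refl = ∈-filter⁺ (InPart? g) (m-covers v) (proj₂ (∈-filter⁻ _ {xs = allFin n} v∈part))

  restrict-feasible : (∀ g → ρ g ℕ.≤ partSize c g) → ∀ {m} → IsMatching (AdjH adj c ρ) m → CoversV m
                    → IsFeasible adj c ρ (restrict m)
  restrict-feasible ρ≤partSize {m} m-matching@(m⊆H , m!) m-covers = restrict-isMatching m-matching , ρ≤matchedIn
    where
    ρ≤matchedIn : ∀ g → ρ g ℕ.≤ matchedIn c g (restrict m)
    ρ≤matchedIn g = subst (ℕ._≤ matchedIn c g (restrict m)) (ℕₚ.m∸[m∸n]≡n (ρ≤partSize g))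
      (ℕₚ.m≤n+o⇒m∸n≤o (partSize c g) (partSize c g ∸ ρ g) (begin
        partSize c g                                              ≤⟨ partSize≤partCount g m m-covers ⟩
        partCount g m                                             ≡⟨ partCount≡matched+new g m m⊆H ⟩
        matchedIn c g (restrict m) ℕ.+ newPartCount g m           ≤⟨ ℕₚ.+-monoʳ-≤ _ (newPartCount≤ g m m!) ⟩
        matchedIn c g (restrict m) ℕ.+ (partSize c g ∸ ρ g)       ≡⟨ ℕₚ.+-comm (matchedIn c g (restrict m)) _ ⟩
        (partSize c g ∸ ρ g) ℕ.+ matchedIn c g (restrict m)       ∎))
      where open ℕₚ.≤-Reasoning

  endpoints-map-lift : ∀ m → endpoints (map lift m) ≡ map inj₁ (endpoints m)
  endpoints-map-lift [] = refl
  endpoints-map-lift ((u , v) ∷ m) = cong (λ vs → inj₁ u ∷ inj₁ v ∷ vs) (endpoints-map-lift m)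

  restrict-map-lift : ∀ m → restrict (map lift m) ≡ m
  restrict-map-lift = mapMaybe-map-retract λ _ → refl

  restrict-++ : ∀ xs ys → restrict (xs ++ ys) ≡ restrict xs ++ restrict ys
  restrict-++ = mapMaybe-++ _

  restrict-zip-newPart : ∀ g (us : List (Fin n)) is → restrict (zip (map inj₁ us) (map (new g) is)) ≡ []
  restrict-zip-newPart g [] _ = refl
  restrict-zip-newPart g (_ ∷ _) [] = refl
  restrict-zip-newPart g (_ ∷ us) (_ ∷ is) = restrict-zip-newPart g us is

  module Extension {m : List (Fin n × Fin n)} (m-feasible : IsFeasible adj c ρ m) where

    unmatched : Fin ω → List (Fin n)
    unmatched g = filter (λ v → ¬? (any? (v Finₚ.≟_) (endpoints m))) (filter (λ v → c v Finₚ.≟ g) (allFin n))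

    ∈-unmatched⁻ : ∀ {g v} → v ∈ unmatched g → c v ≡ g × v ∉ endpoints m
    ∈-unmatched⁻ {g} v∈ = let v∈part , v∉m = ∈-filter⁻ _ {xs = filter _ (allFin n)} v∈
                          in proj₂ (∈-filter⁻ (λ v → c v Finₚ.≟ g) {xs = allFin n} v∈part) , v∉m

    ∈-unmatched⁺ : ∀ {v} → v ∉ endpoints m → v ∈ unmatched (c v)
    ∈-unmatched⁺ {v} v∉m = ∈-filter⁺ _ (∈-filter⁺ (λ w → c w Finₚ.≟ c v) (∈-allFin v) refl) v∉m

    unmatched-Unique : ∀ g → Unique (unmatched g)
    unmatched-Unique g = Unique.filter⁺ _ (Unique.filter⁺ _ (Unique.allFin⁺ n))

    length-unmatched≤ : ∀ g → length (unmatched g) ℕ.≤ partSize c g ∸ ρ g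
    length-unmatched≤ g = ℕₚ.≤-trans (ℕₚ.m+n≤o⇒m≤o∸n (length (unmatched g)) (begin
        length (unmatched g) ℕ.+ matchedIn c g m ≡⟨ length-++ (unmatched g) ⟨
        length (unmatched g ++ matched)          ≤⟨ Unique-⊆⇒length≤ unmatched++matched-Unique
                                                                      unmatched++matched⊆part ⟩
        partSize c g                             ∎))
      (ℕₚ.∸-monoʳ-≤ (partSize c g) (proj₂ m-feasible g))
      where
      open ℕₚ.≤-Reasoning
      matched = filter (λ v → c v Finₚ.≟ g) (endpoints m)
      unmatched++matched-Unique : Unique (unmatched g ++ matched)
      unmatched++matched-Unique = Unique.++⁺ (unmatched-Unique g) (Unique.filter⁺ _ (proj₂ (proj₁ m-feasible)))
        λ (v∈unmatched , v∈matched) →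
          proj₂ (∈-unmatched⁻ v∈unmatched) (proj₁ (∈-filter⁻ _ {xs = endpoints m} v∈matched))
      unmatched++matched⊆part : unmatched g ++ matched ⊆ filter (λ v → c v Finₚ.≟ g) (allFin n)
      unmatched++matched⊆part v∈ with ∈-++⁻ (unmatched g) v∈
      ... | inj₁ v∈unmatched = proj₁ (∈-filter⁻ _ {xs = filter _ (allFin n)} v∈unmatched)
      ... | inj₂ v∈matched = ∈-filter⁺ _ (∈-allFin _) (proj₂ (∈-filter⁻ _ {xs = endpoints m} v∈matched))

    pairs : Fin ω → List (VH c ρ × VH c ρ)
    pairs g = zip (map inj₁ (unmatched g)) (newPart g)

    newEdges : List (VH c ρ × VH c ρ)
    newEdges = concatMap pairs (allFin ω)

    extension : List (VH c ρ × VH c ρ)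
    extension = map lift m ++ newEdges

    ∈-endpoints-pairs⁻ : ∀ g {x} → x ∈ endpoints (pairs g)
                       → (∃[ v ] v ∈ unmatched g × x ≡ inj₁ v) ⊎ (∃[ i ] x ≡ new g i)
    ∈-endpoints-pairs⁻ g x∈ with ∈-endpoints-zip⁻ (map inj₁ (unmatched g)) (newPart g) x∈
    ... | inj₁ x∈unmatched = inj₁ (∈-map⁻ inj₁ x∈unmatched)
    ... | inj₂ x∈newPart = let i , _ , x≡new = ∈-map⁻ (new g) x∈newPart in inj₂ (i , x≡new)

    pairs-group : ∀ g {x} → x ∈ endpoints (pairs g) → group x ≡ g
    pairs-group g x∈ with ∈-endpoints-pairs⁻ g x∈
    ... | inj₁ (_ , v∈unmatched , refl) = proj₁ (∈-unmatched⁻ v∈unmatched)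
    ... | inj₂ (_ , refl) = refl

    pairs-Unique : ∀ g → Unique (endpoints (pairs g))
    pairs-Unique g = endpoints-zip-Unique (Unique.map⁺ inj₁-injective (unmatched-Unique g)) (newPart-Unique g)
      λ (x∈V , x∈newPart) → case ∈-map⁻ inj₁ x∈V , ∈-map⁻ (new g) x∈newPart of λ where
        ((_ , _ , refl) , (_ , _ , ()))

    pairs-edges : ∀ g → All EdgeH (pairs g)
    pairs-edges g = All-zip λ x∈ y∈ → case ∈-map⁻ inj₁ x∈ , ∈-map⁻ (new g) y∈ of λ where
      ((_ , u∈unmatched , refl) , (_ , _ , refl)) → proj₁ (∈-unmatched⁻ u∈unmatched)

    endpoints-extension : endpoints extension ≡ map inj₁ (endpoints m) ++ concatMap (endpoints ∘ pairs) (allFin ω)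
    endpoints-extension = trans (concatMap-++ _ (map lift m) newEdges)
      (cong₂ _++_ (endpoints-map-lift m) (endpoints-concatMap pairs (allFin ω)))

    extension-Unique : Unique (endpoints extension)
    extension-Unique = subst Unique (sym endpoints-extension) (Unique.++⁺
      (Unique.map⁺ inj₁-injective (proj₂ (proj₁ m-feasible)))
      (Unique-concatMap group (endpoints ∘ pairs) (Unique.allFin⁺ ω) pairs-Unique pairs-group)
      old#new)
      where
      old#new : Disjoint (map inj₁ (endpoints m)) (concatMap (endpoints ∘ pairs) (allFin ω))
      old#new (x∈m , x∈new) with ∈-map⁻ inj₁ x∈m | ∈-concat⁻′ (map (endpoints ∘ pairs) (allFin ω)) x∈new
      ... | v , v∈m , refl | _ , x∈pairs , pairs∈ with ∈-map⁻ (endpoints ∘ pairs) pairs∈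
      ...   | g , _ , refl with ∈-endpoints-pairs⁻ g x∈pairs
      ...     | inj₁ (_ , v∈unmatched , refl) = proj₂ (∈-unmatched⁻ v∈unmatched) v∈m

    extension-isMatching : IsMatching (AdjH adj c ρ) extension
    extension-isMatching = All.++⁺ (All.map⁺ (proj₁ (proj₁ m-feasible))) newEdges-edges , extension-Unique
      where
      newEdges-edges : All EdgeH newEdges
      newEdges-edges = All.concat⁺ (All.map⁺ {xs = allFin ω} (All.tabulate λ {g} _ → pairs-edges g))

    extension-covers : CoversV extension
    extension-covers v =
      subst (inj₁ v ∈_) (sym endpoints-extension) (old-or-new (any? (v Finₚ.≟_) (endpoints m)))
      where
      unmatched≤newPart : length (map inj₁ (unmatched (c v))) ℕ.≤ length (newPart (c v))
      unmatched≤newPart = subst₂ ℕ._≤_ (sym (length-map inj₁ (unmatched (c v)))) (sym (length-newPart (c v)))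
                                 (length-unmatched≤ (c v))
      old-or-new : Dec (v ∈ endpoints m) → inj₁ v ∈ map inj₁ (endpoints m) ++ concatMap (endpoints ∘ pairs) (allFin ω)
      old-or-new (yes v∈m) = ∈-++⁺ˡ (∈-map⁺ inj₁ v∈m)
      old-or-new (no v∉m) = ∈-++⁺ʳ _ (∈-concat⁺′
        (∈-endpoints-zip⁺ (∈-map⁺ inj₁ (∈-unmatched⁺ v∉m)) unmatched≤newPart)
        (∈-map⁺ (endpoints ∘ pairs) (∈-allFin (c v))))

    restrict-extension : restrict extension ≡ m
    restrict-extension = begin
      restrict (map lift m ++ newEdges)           ≡⟨ restrict-++ (map lift m) newEdges ⟩
      restrict (map lift m) ++ restrict newEdges  ≡⟨ cong₂ _++_ (restrict-map-lift m) (restrict-pairs (allFin ω)) ⟩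
      m ++ []                                     ≡⟨ ++-identityʳ m ⟩
      m                                           ∎
      where
      open ≡-Reasoning
      restrict-pairs : ∀ gs → restrict (concatMap pairs gs) ≡ []
      restrict-pairs [] = refl
      restrict-pairs (g ∷ gs) = trans (restrict-++ (pairs g) (concatMap pairs gs))
        (cong₂ _++_ (restrict-zip-newPart g (unmatched g) (allFin _)) (restrict-pairs gs))

    extension-weight : ∀ p M → weight (weightH c ρ p M) extension + weight p m ≡ n · M
    extension-weight p M = begin
      wH[extension] + weight p m                    ≡⟨ cong (λ m′ → wH[extension] + weight p m′) restrict-extension ⟨
      wH[extension] + weight p (restrict extension) ≡⟨ weightH-identity p M extension ⟩
      length (covered extension) · M                ≡⟨ cong (_· M) length-covered≡n ⟩
      n · M                                         ∎
      where
      open ≡-Reasoning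
      wH[extension] = weight (weightH c ρ p M) extension
      length-covered≡n : length (covered extension) ≡ n
      length-covered≡n = ℕₚ.≤-antisym (length-covered≤n extension extension-Unique)
                                       (CoversV⇒n≤length-covered extension extension-covers)

lemma13 : (n ω : ℕ) (adj : Fin n → Fin n → Bool)
    → (∀ u v → adj u v ≡ adj v u) → (∀ u → adj u u ≡ false)
    → (p : Fin n → Fin n → ℚ) → (∀ u v → p u v ≡ p v u) → (∀ u v → 0ℚ ≤ p u v)
    → (c : Fin n → Fin ω) (ρ : Fin ω → ℕ) → (∀ g → ρ g Data.Nat.≤ partSize c g)
    → (M : ℚ) → totalWeight adj p < M
    → Σ (List (Fin n × Fin n)) (IsFeasible adj c ρ)
    → (MH : List (VH c ρ × VH c ρ))
    → IsMatching (AdjH adj c ρ) MH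
    → (∀ (m : List (VH c ρ × VH c ρ)) → IsMatching (AdjH adj c ρ) m
         → weight (weightH c ρ p M) m ≤ weight (weightH c ρ p M) MH)
    → IsFeasible adj c ρ (restrictToG {c = c} {ρ = ρ} MH)
      × (∀ (m : List (Fin n × Fin n)) → IsFeasible adj c ρ m
           → weight p (restrictToG {c = c} {ρ = ρ} MH) ≤ weight p m)
lemma13 n ω adj adj-sym adj-irr p p-sym p≥0 c ρ ρ≤partSize M ΣE<M (m₀ , m₀-feasible) MH MH-matching MH-maximum =
  restrict-feasible ρ≤partSize MH-matching MH-covers , λ m m-feasible → proj₂ (comparison m-feasible)
  where
  open AuxiliaryGraph adj c ρ

  p[m]<M : ∀ {m} → IsFeasible adj c ρ m → weight p m < M
  p[m]<M (m-matching , _) = ℚₚ.≤-<-trans (weight≤totalWeight adj-sym adj-irr p-sym p≥0 m-matching) ΣE<M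

  0≤M : 0ℚ ≤ M
  0≤M = ℚₚ.<⇒≤ (ℚₚ.≤-<-trans (weight-nonNeg p p≥0 (edges adj)) ΣE<M)

  comparison : ∀ {m} → IsFeasible adj c ρ m → length (covered MH) ≡ n × weight p (restrict MH) ≤ weight p m
  comparison m-feasible = MH-saturated , p+q≡r+s∧r≤p⇒q≤s
      (trans (weightH-identity p M MH) (trans (cong (_· M) MH-saturated) (sym (extension-weight p M)))) MH≥extension
    where
    open Extension m-feasible
    MH≥extension = MH-maximum extension extension-isMatching
    MH-saturated = multiplicity-forced 0≤M (length-covered≤n MH (proj₂ MH-matching)) (weightH-identity p M MH)
                     (extension-weight p M) MH≥extension (weight-nonNeg p p≥0 (restrict MH)) (p[m]<M m-feasible)

  MH-covers : CoversV MH
  MH-covers = n≤length-covered⇒CoversV MH (proj₂ MH-matching)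
                (ℕₚ.≤-reflexive (sym (proj₁ (comparison m₀-feasible))))
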